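{- For every positive integer $n$, \[ \sum_{k=0}^{n-1}F_{k-1}\,\mathbb{F}_{k}=F_{n}\,\mathbb{F}_{n}-n. \]
   Context: $F_n$ denotes the Fibonacci numbers: $F_0=0$, $F_1=1$, $F_{n+2}=F_{n+1}+F_n$, extended backwards by the same recurrence so that $F_{ -1}=1$. The $n$-th harmonic Fibonacci number is $\mathbb{F}_{n}=\sum_{k=1}^{n}\frac{1}{F_{k}}$ for $n\ge 1$, with $\mathbb{F}_0=0$. -}

module Defs where

open import Data.Nat using (ℕ; zero; suc)
open import Data.Integer using (+_)
open import Data.Rational using (ℚ; 0ℚ; _+_; _/_)

fib : ℕ → ℕ
fib zero = 0
fib (suc zero) = 1
fib (suc (suc n)) = fib (suc n) Data.Nat.+ fib n

-- fibPrev k = F_{k-1}, with F_{-1} = 1 (backward extension of the recurrence)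
fibPrev : ℕ → ℕ
fibPrev zero = 1
fibPrev (suc k) = fib k

-- reciprocal of a natural number as a rational; only used at F_k with k ≥ 1,
-- where F_k ≥ 1 (the value at 0 is irrelevant and set to 0)
recipℕ : ℕ → ℚ
recipℕ zero = 0ℚ
recipℕ (suc m) = + 1 / suc m

hfib : ℕ → ℚ
hfib zero = 0ℚ
hfib (suc n) = hfib n + recipℕ (fib (suc n))

sumTo : ℕ → (ℕ → ℚ) → ℚ
sumTo zero f = 0ℚ
sumTo (suc n) f = sumTo n f + f n

{-# OPTIONS --safe #-}
-- Telescoping: since F_{n-1} + F_n = F_{n+1} and F_{n+1} 𝔽_{n+1} = F_{n+1} 𝔽_n + 1,
-- adding F_{n-1} 𝔽_n to F_n 𝔽_n − n gives F_{n+1} 𝔽_{n+1} − (n + 1).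
module Submission where

open import Defs
open import Data.Nat as ℕ using (ℕ; zero; suc; NonZero; _≤_; s≤s; z≤n)
import Data.Nat.Properties as ℕ
open import Data.Integer as ℤ using (+_)
import Data.Integer.Properties as ℤ
open import Data.Rational using (ℚ; _+_; _*_; _-_; _/_; 1ℚ; fromℚᵘ)
open import Data.Rational.Properties
  using (toℚᵘ-injective; toℚᵘ-fromℚᵘ; toℚᵘ-homo-+; toℚᵘ-homo-*; fromℚᵘ-cong; *-distribˡ-+)
import Data.Rational.Unnormalised as ℚᵘ
import Data.Rational.Unnormalised.Properties as ℚᵘ
open import Data.Rational.Solver using (module +-*-Solver)
open import Relation.Binary.PropositionalEquality
open +-*-Solver

fromℕ : ℕ → ℚ
fromℕ n = + n / 1

fromℚᵘ-homo-+ : ∀ p q → fromℚᵘ (p ℚᵘ.+ q) ≡ fromℚᵘ p + fromℚᵘ q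
fromℚᵘ-homo-+ p q = toℚᵘ-injective (ℚᵘ.≃-trans (toℚᵘ-fromℚᵘ (p ℚᵘ.+ q))
  (ℚᵘ.≃-sym (ℚᵘ.≃-trans (toℚᵘ-homo-+ (fromℚᵘ p) (fromℚᵘ q))
                        (ℚᵘ.+-cong (toℚᵘ-fromℚᵘ p) (toℚᵘ-fromℚᵘ q)))))

fromℚᵘ-homo-* : ∀ p q → fromℚᵘ (p ℚᵘ.* q) ≡ fromℚᵘ p * fromℚᵘ q
fromℚᵘ-homo-* p q = toℚᵘ-injective (ℚᵘ.≃-trans (toℚᵘ-fromℚᵘ (p ℚᵘ.* q))
  (ℚᵘ.≃-sym (ℚᵘ.≃-trans (toℚᵘ-homo-* (fromℚᵘ p) (fromℚᵘ q))
                        (ℚᵘ.*-cong (toℚᵘ-fromℚᵘ p) (toℚᵘ-fromℚᵘ q)))))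

-- fromℕ n and recipℕ (suc m) are, by definition, fromℚᵘ of the unnormalised fractions n/1 and 1/(m+1),
-- so their arithmetic can be checked in ℚᵘ.
fromℕ-homo-+ : ∀ m n → fromℕ (m ℕ.+ n) ≡ fromℕ m + fromℕ n
fromℕ-homo-+ m n = trans (fromℚᵘ-cong {ℚᵘ.mkℚᵘ (+ (m ℕ.+ n)) 0} {m′ ℚᵘ.+ n′} (ℚᵘ.*≡* lhs≡rhs)) (fromℚᵘ-homo-+ m′ n′)
  where
  m′ n′ : ℚᵘ.ℚᵘ
  m′ = ℚᵘ.mkℚᵘ (+ m) 0
  n′ = ℚᵘ.mkℚᵘ (+ n) 0

  lhs≡rhs : + (m ℕ.+ n) ℤ.* + 1 ≡ (+ m ℤ.* + 1 ℤ.+ + n ℤ.* + 1) ℤ.* + 1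
  lhs≡rhs = cong (ℤ._* + 1) (trans (ℤ.pos-+ m n)
    (sym (cong₂ ℤ._+_ (ℤ.*-identityʳ (+ m)) (ℤ.*-identityʳ (+ n)))))

fromℕ-*-recipℕ : ∀ n .{{_ : NonZero n}} → fromℕ n * recipℕ n ≡ 1ℚ
fromℕ-*-recipℕ (suc m) = trans (sym (fromℚᵘ-homo-* n′ n⁻¹)) (fromℚᵘ-cong {n′ ℚᵘ.* n⁻¹} {ℚᵘ.1ℚᵘ} n′*n⁻¹≃1)
  where
  n′ n⁻¹ : ℚᵘ.ℚᵘ
  n′  = ℚᵘ.mkℚᵘ (+ suc m) 0
  n⁻¹ = ℚᵘ.mkℚᵘ (+ 1) m

  n′*n⁻¹≃1 : n′ ℚᵘ.* n⁻¹ ℚᵘ.≃ ℚᵘ.1ℚᵘ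
  n′*n⁻¹≃1 = ℚᵘ.*≡* (trans (ℤ.*-identityʳ _) (trans (ℤ.*-identityʳ (+ suc m))
    (sym (trans (ℤ.*-identityˡ _) (ℤ.*-identityˡ _)))))

fib-suc-positive : ∀ n → 1 ≤ fib (suc n)
fib-suc-positive zero    = s≤s z≤n
fib-suc-positive (suc n) = ℕ.≤-trans (fib-suc-positive n) (ℕ.m≤m+n (fib (suc n)) (fib n))

fibPrev-+-fib : ∀ n → fibPrev n ℕ.+ fib n ≡ fib (suc n)
fibPrev-+-fib zero    = refl
fibPrev-+-fib (suc n) = ℕ.+-comm (fib n) (fib (suc n))

sum-fibPrev-hfib : ∀ n → sumTo n (λ k → fromℕ (fibPrev k) * hfib k) ≡ fromℕ (fib n) * hfib n - fromℕ n
sum-fibPrev-hfib zero    = refl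
sum-fibPrev-hfib (suc n) = begin
  sumTo n (λ k → fromℕ (fibPrev k) * hfib k) + p * h  ≡⟨ cong (_+ p * h) (sum-fibPrev-hfib n) ⟩
  (f * h - N) + p * h                                 ≡⟨ rearrange f h N p ⟩
  (p + f) * h + 1ℚ - (1ℚ + N)                         ≡⟨ cong₂ (λ a b → a * h + b - (1ℚ + N)) p+f≡F (sym F*r≡1) ⟩
  F * h + F * r - (1ℚ + N)                            ≡⟨ cong₂ _-_ (sym (*-distribˡ-+ F h r)) (sym (fromℕ-homo-+ 1 n)) ⟩
  F * (h + r) - fromℕ (suc n)                         ∎
  where
  open ≡-Reasoning
  p f F h r N : ℚ
  p = fromℕ (fibPrev n)
  f = fromℕ (fib n)
  F = fromℕ (fib (suc n))
  h = hfib n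
  r = recipℕ (fib (suc n))
  N = fromℕ n

  rearrange : ∀ f h N p → (f * h - N) + p * h ≡ (p + f) * h + 1ℚ - (1ℚ + N)
  rearrange = solve 4 (λ f h N p → (f :* h :- N) :+ p :* h := (p :+ f) :* h :+ con 1ℚ :- (con 1ℚ :+ N)) refl

  p+f≡F : p + f ≡ F
  p+f≡F = trans (sym (fromℕ-homo-+ (fibPrev n) (fib n))) (cong fromℕ (fibPrev-+-fib n))

  F*r≡1 : F * r ≡ 1ℚ
  F*r≡1 = fromℕ-*-recipℕ (fib (suc n)) {{ℕ.>-nonZero (fib-suc-positive n)}}

-- The identity also holds for n = 0.
mainTheorem7 : (n : ℕ) → .{{_ : NonZero n}} →
    sumTo n (λ k → (+ fibPrev k / 1) * hfib k) ≡ (+ fib n / 1) * hfib n - (+ n / 1)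
mainTheorem7 n = sum-fibPrev-hfib n
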